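{- For any integers $n$, $k$ and $\ell\in\{2,\dotsc,k-1\}$, the banana tree $B_{k,n}$ is $B_{\ell,n}$-supermagic. In particular, $B_{k,n}$ is $B_{k-1,n}$-supermagic.
   Context: All graphs are finite, undirected and simple. Let $H$ be the graph obtained by taking a star with $n$ vertices and joining an additional vertex $v$ to exactly one leaf of the star. For a positive integer $k$, $A_k(H,v)$ denotes the graph obtained by taking $k$ disjoint copies of $H$ and identifying the $k$ copies of $v$ into a single vertex. The banana tree is $B_{k,n}=A_k(H,v)$. A graph $\Gamma=(V,E)$ admits an $H'$-covering if every edge belongs to a subgraph isomorphic to $H'$; it is $H'$-supermagic if there is a bijection $f:V\cup E\to\{1,\dotsc,|V|+|E|\}$ with $f(V)=\{1,\dotsc,|V|\}$ and a constant $c$ such that $\sum_{u\in V(K)}f(u)+\sum_{e\in E(K)}f(e)=c$ for every subgraph $K\subseteq\Gamma$ with $K\cong H'$. -}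

module Defs where

open import Data.Nat using (ℕ; zero; suc; _+_; _*_; _≤_; _<_; s≤s; z≤n)
open import Data.Fin using (Fin; zero; suc; toℕ; remQuot; combine)
open import Data.Bool using (Bool; true; false; if_then_else_)
open import Data.Product using (Σ; ∃; _×_; _,_; proj₁; proj₂)
open import Data.Sum using (_⊎_; inj₁; inj₂)
open import Relation.Binary.PropositionalEquality using (_≡_)

ΣFin : (n : ℕ) → (Fin n → ℕ) → ℕ
ΣFin zero    f = 0
ΣFin (suc n) f = f zero + ΣFin n (λ i → f (suc i))

record Graph : Set where
  field
    nV   : ℕ
    nE   : ℕ
    ends : Fin nE → Fin nV × Fin nV
open Graph public

Joins : (G : Graph) → Fin (nE G) → Fin (nV G) → Fin (nV G) → Set
Joins G e u w = (ends G e ≡ (u , w)) ⊎ (ends G e ≡ (w , u))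

record Subgraph (G : Graph) : Set where
  field
    VK     : Fin (nV G) → Bool
    EK     : Fin (nE G) → Bool
    closed : ∀ e → EK e ≡ true →
               (VK (proj₁ (ends G e)) ≡ true) × (VK (proj₂ (ends G e)) ≡ true)
open Subgraph public

record _≅_ {G : Graph} (K : Subgraph G) (H : Graph) : Set where
  field
    φ      : Fin (nV H) → Fin (nV G)
    φ-inj  : ∀ a b → φ a ≡ φ b → a ≡ b
    φ-into : ∀ a → VK K (φ a) ≡ true
    φ-onto : ∀ u → VK K u ≡ true → ∃ λ a → φ a ≡ u
    adj→   : ∀ a b → (∃ λ h → Joins H h a b) →
               ∃ λ e → (EK K e ≡ true) × Joins G e (φ a) (φ b)
    adj←   : ∀ a b → (∃ λ e → (EK K e ≡ true) × Joins G e (φ a) (φ b)) →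
               ∃ λ h → Joins H h a b

Covering : (G H : Graph) → Set
Covering G H = ∀ e → ∃ λ (K : Subgraph G) → (K ≅ H) × (EK K e ≡ true)

-- Total labelling: f : V ⊎ E → Fin (|V|+|E|); the actual label of x is 1 + toℕ (f x),
-- so labels range over {1, …, |V|+|E|}.
Labelling : Graph → Set
Labelling G = Fin (nV G) ⊎ Fin (nE G) → Fin (nV G + nE G)

label : {G : Graph} → Labelling G → Fin (nV G) ⊎ Fin (nE G) → ℕ
label f x = suc (toℕ (f x))

IsBijection : {A B : Set} → (A → B) → Set
IsBijection f = (∀ x y → f x ≡ f y → x ≡ y) × (∀ b → ∃ λ a → f a ≡ b)

VerticesFirst : (G : Graph) → Labelling G → Set
VerticesFirst G f = (∀ u → label {G} f (inj₁ u) ≤ nV G)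
                  × (∀ i → 1 ≤ i → i ≤ nV G → ∃ λ u → label {G} f (inj₁ u) ≡ i)

weight : {G : Graph} → Labelling G → Subgraph G → ℕ
weight {G} f K =
  ΣFin (nV G) (λ u → if VK K u then label {G} f (inj₁ u) else 0)
  + ΣFin (nE G) (λ e → if EK K e then label {G} f (inj₂ e) else 0)

Supermagic : (G H : Graph) → Set
Supermagic G H =
  Covering G H ×
  ∃ λ (f : Labelling G) → IsBijection f × VerticesFirst G f ×
    ∃ λ (c : ℕ) → ∀ (K : Subgraph G) → K ≅ H → weight {G} f K ≡ c

-- Vertex 0 is the common vertex v; vertex
-- 1 + combine i j is vertex j of copy i (i < k, j < n): j = 0 is the star centre,
-- j ≥ 1 are the n-1 leaves, and leaf j = 1 is the one joined to v.
-- Edge combine i 0 is v — (i,1); edge combine i j (j ≥ 1) is (i,0) — (i,j).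
Banana : (k n : ℕ) → 2 ≤ n → Graph
Banana k (suc (suc m)) (s≤s (s≤s z≤n)) = record
  { nV = suc (k * n) ; nE = k * n ; ends = ends' }
  where
  n : ℕ
  n = suc (suc m)
  vtx : Fin k → Fin n → Fin (suc (k * n))
  vtx i j = suc (combine i j)
  endsAux : Fin k × Fin n → Fin (suc (k * n)) × Fin (suc (k * n))
  endsAux (i , zero)  = (zero , vtx i (suc zero))
  endsAux (i , suc j) = (vtx i zero , vtx i (suc j))
  ends' : Fin (k * n) → Fin (suc (k * n)) × Fin (suc (k * n))
  ends' e = endsAux (remQuot n e)

-- Root the banana tree at the common vertex v. Every other vertex x has a unique edge e(x) on
-- its path to v, and x ↦ e(x) is a bijection; label the vertices 1, …, |V| with v getting 1,
-- and give e(x) the label that makes label(x) + label(e(x)) a constant C. A subgraph K ≅ B_{ℓ,n}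
-- has ℓn + 1 vertices, so it cannot lie inside one copy of H and must contain v; being
-- connected it then contains, with each vertex x, the path from x to v. Hence the edges of K
-- are exactly the e(x) for x ∈ K ∖ {v}, and the weight of K is 1 + ℓn·C.
module Submission where

open import Defs
open import Data.Nat using (ℕ; zero; suc; _+_; _*_; _≤_; _<_; _∸_; s≤s; z≤n)
open import Data.Nat.Properties
  using (+-*-semiring; *-identityˡ; *-identityʳ; *-zeroʳ; m≤m+n; <⇒≱; m+[n∸m]≡n; <⇒≤; ≤-trans; ∸-monoˡ-≤; m∸n≤m)
  renaming (suc-injective to ℕ-suc-injective)
open import Data.Nat.Tactic.RingSolver using (solve-∀)
open import Data.Fin using (Fin; zero; suc; toℕ; combine; remQuot; punchIn; inject≤; opposite; fromℕ<; _↑ˡ_; _↑ʳ_)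
open import Data.Fin.Properties
  using (_≟_; any?; +↔⊎; remQuot-combine; combine-remQuot; combine-injective; suc-injective;
         punchInᵢ≢i; punchIn-injective; inject≤-injective; injective⇒≤; toℕ-↑ˡ; toℕ-↑ʳ; toℕ<n;
         toℕ-fromℕ<; 0≢1+n; opposite-prop; opposite-involutive)
open import Data.Bool using (Bool; true; false; if_then_else_)
open import Data.Bool.Properties using (⇔→≡)
open import Data.Product using (Σ; ∃; _×_; _,_; proj₁; proj₂)
import Data.Product as Product
open import Data.Sum using (_⊎_; inj₁; inj₂; swap)
import Data.Sum as Sum
open import Function using (_∘_)
open import Function.Bundles using (_↔_; Inverse; _⇔_; Equivalence; mk⇔; mk↔ₛ′)
open import Function.Definitions using (Injective)
open import Function.Construct.Composition using (_↔-∘_; _⇔-∘_)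
open import Function.Construct.Symmetry using (↔-sym; ⇔-sym)
open import Function.Construct.Identity using (↔-id)
open import Data.Sum.Function.Propositional using (_⊎-↔_)
open import Algebra.Properties.Semiring.Sum +-*-semiring
  using (sum; sum-cong-≗; sum-remove; ∑-distrib-+; sum-permute; *-distribʳ-sum)
open import Relation.Nullary using (does; yes; no; contradiction)
open import Relation.Nullary.Decidable using (dec-true; dec-false)
open import Relation.Binary.PropositionalEquality
open ≡-Reasoning

open Equivalence using (to; from)

ΣFin≡sum : ∀ n (f : Fin n → ℕ) → ΣFin n f ≡ sum f
ΣFin≡sum zero    f = refl
ΣFin≡sum (suc n) f = cong (f zero +_) (ΣFin≡sum n (f ∘ suc))

sum-const : ∀ n c → sum {n} (λ _ → c) ≡ n * c
sum-const zero    c = refl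
sum-const (suc n) c = cong (c +_) (sum-const n c)

sum-isolate : ∀ {N} (f : Fin N → ℕ) u →
              sum f ≡ f u + sum (λ w → if does (w ≟ u) then 0 else f w)
sum-isolate {suc N} f u = begin
  sum f                        ≡⟨ sum-remove {i = u} f ⟩
  f u + sum (f ∘ punchIn u)    ≡⟨ cong (f u +_) (sum-cong-≗ agree) ⟩
  f u + sum (f′ ∘ punchIn u)   ≡⟨ cong (f u +_) sum-f′ ⟨
  f u + sum f′                 ∎
  where
  f′ : Fin (suc N) → ℕ
  f′ w = if does (w ≟ u) then 0 else f w
  f′u≡0 : f′ u ≡ 0
  f′u≡0 rewrite dec-true (u ≟ u) refl = refl
  agree : ∀ j → f (punchIn u j) ≡ f′ (punchIn u j)
  agree j rewrite dec-false (punchIn u j ≟ u) (punchInᵢ≢i u j) = refl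
  sum-f′ : sum f′ ≡ sum (f′ ∘ punchIn u)
  sum-f′ = trans (sum-remove {i = u} f′) (cong (_+ sum (f′ ∘ punchIn u)) f′u≡0)

sum-image : ∀ {m N} (f : Fin N → ℕ) (φ : Fin m → Fin N) → Injective _≡_ _≡_ φ →
            (∀ u → (∀ a → φ a ≢ u) → f u ≡ 0) → sum f ≡ sum (f ∘ φ)
sum-image {zero}  {N} f φ _ vanish =
  trans (sum-cong-≗ (λ u → vanish u (λ ()))) (trans (sum-const N 0) (*-zeroʳ N))
sum-image {suc m} f φ φ-inj vanish = begin
  sum f                            ≡⟨ sum-isolate f (φ zero) ⟩
  f (φ zero) + sum f′              ≡⟨ cong (f (φ zero) +_) (sum-image f′ (φ ∘ suc) (suc-injective ∘ φ-inj) vanish′) ⟩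
  f (φ zero) + sum (f′ ∘ φ ∘ suc)  ≡⟨ cong (f (φ zero) +_) (sum-cong-≗ f′-φsuc) ⟩
  f (φ zero) + sum (f ∘ φ ∘ suc)   ∎
  where
  f′ : Fin _ → ℕ
  f′ w = if does (w ≟ φ zero) then 0 else f w
  f′-φsuc : ∀ a → f′ (φ (suc a)) ≡ f (φ (suc a))
  f′-φsuc a rewrite dec-false (φ (suc a) ≟ φ zero) (0≢1+n ∘ sym ∘ φ-inj) = refl
  vanish′ : ∀ u → (∀ a → φ (suc a) ≢ u) → f′ u ≡ 0
  vanish′ u notImage with u ≟ φ zero
  ... | yes _  = refl
  ... | no u≢φ₀ = vanish u λ { zero → u≢φ₀ ∘ sym ; (suc a) → notImage a }

↔⇒IsBijection : ∀ {A B : Set} (f : A ↔ B) → IsBijection (Inverse.to f)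
↔⇒IsBijection f =
  (λ x y eq → trans (sym (strictlyInverseʳ x)) (trans (cong from′ eq) (strictlyInverseʳ y))) ,
  (λ b → from′ b , strictlyInverseˡ b)
  where open Inverse f renaming (from to from′)

data Walk (G : Graph) (S : Fin (nE G) → Bool) : Fin (nV G) → Fin (nV G) → Set where
  []   : ∀ {x} → Walk G S x x
  step : ∀ {x y z} e → S e ≡ true → Joins G e x y → Walk G S y z → Walk G S x z

module _ {G : Graph} {S : Fin (nE G) → Bool} where

  _++ʷ_ : ∀ {x y z} → Walk G S x y → Walk G S y z → Walk G S x z
  []               ++ʷ w′ = w′
  step e Se j w    ++ʷ w′ = step e Se j (w ++ʷ w′)

  reverseʷ : ∀ {x y} → Walk G S x y → Walk G S y x
  reverseʷ []             = []
  reverseʷ (step e Se j w) = reverseʷ w ++ʷ step e Se (swap j) []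

  walk-transport : (P : Fin (nV G) → Set) →
                   (∀ e → S e ≡ true → P (proj₁ (ends G e)) ⇔ P (proj₂ (ends G e))) →
                   ∀ {x y} → Walk G S x y → P x → P y
  walk-transport P invariant []                       p = p
  walk-transport P invariant (step e Se (inj₁ ends≡) w) p =
    walk-transport P invariant w (forward (invariant e Se) ends≡ p)
    where
    forward : ∀ {pr x y} → P (proj₁ pr) ⇔ P (proj₂ pr) → pr ≡ (x , y) → P x → P y
    forward p⇔ refl = to p⇔
  walk-transport P invariant (step e Se (inj₂ ends≡) w) p =
    walk-transport P invariant w (backward (invariant e Se) ends≡ p)
    where
    backward : ∀ {pr x y} → P (proj₁ pr) ⇔ P (proj₂ pr) → pr ≡ (y , x) → P x → P y
    backward p⇔ refl = from p⇔

module _ {G H : Graph} {K : Subgraph G} (iso : K ≅ H) where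
  open _≅_ iso

  ≅-walk : ∀ {a b} → Walk H (λ _ → true) a b → Walk G (EK K) (φ a) (φ b)
  ≅-walk []             = []
  ≅-walk (step h _ j w) with adj→ _ _ (h , j)
  ... | e , e∈K , j′ = step e e∈K j′ (≅-walk w)

  ≅-connected : (root : Fin (nV H)) → (∀ a → Walk H (λ _ → true) a root) →
                ∀ {u w} → VK K u ≡ true → VK K w ≡ true → Walk G (EK K) u w
  ≅-connected root connected u∈K w∈K with φ-onto _ u∈K | φ-onto _ w∈K
  ... | a , refl | b , refl = ≅-walk (connected a) ++ʷ reverseʷ (≅-walk (connected b))

  ≅-vertexCount : sum (λ u → if VK K u then 1 else 0) ≡ nV H
  ≅-vertexCount = begin
    sum indicator                 ≡⟨ sum-image indicator φ (φ-inj _ _) vanish ⟩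
    sum (indicator ∘ φ)           ≡⟨ sum-cong-≗ (λ a → cong (λ b → if b then 1 else 0) (φ-into a)) ⟩
    sum {nV H} (λ _ → 1)          ≡⟨ sum-const (nV H) 1 ⟩
    nV H * 1                      ≡⟨ *-identityʳ (nV H) ⟩
    nV H                          ∎
    where
    indicator : Fin (nV G) → ℕ
    indicator u = if VK K u then 1 else 0
    vanish : ∀ u → (∀ a → φ a ≢ u) → indicator u ≡ 0
    vanish u notImage with VK K u in u∈K
    ... | true  = contradiction (proj₂ (φ-onto u u∈K)) (notImage _)
    ... | false = refl

headedBy : ∀ {ℓ k} → ℓ ≤ k → Fin (suc k) → Fin (suc ℓ) → Fin (suc k)
headedBy ℓ≤k i zero    = i
headedBy ℓ≤k i (suc t) = punchIn i (inject≤ t ℓ≤k)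

headedBy-injective : ∀ {ℓ k} (ℓ≤k : ℓ ≤ k) i → Injective _≡_ _≡_ (headedBy ℓ≤k i)
headedBy-injective ℓ≤k i {zero}  {zero}  _  = refl
headedBy-injective ℓ≤k i {zero}  {suc t} eq = contradiction (sym eq) (punchInᵢ≢i i _)
headedBy-injective ℓ≤k i {suc t} {zero}  eq = contradiction eq (punchInᵢ≢i i _)
headedBy-injective ℓ≤k i {suc t} {suc u} eq =
  cong suc (inject≤-injective ℓ≤k ℓ≤k t u (punchIn-injective i _ _ eq))

pattern hub = zero

module Bananas (m : ℕ) where
  n : ℕ
  n = suc (suc m)

  B : ℕ → Graph
  B k = Banana k n (s≤s (s≤s z≤n))

  vertex : ∀ {k} → Fin k → Fin n → Fin (suc (k * n))
  vertex i j = suc (combine i j)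

  vertex-injective : ∀ {k} {i i′ : Fin k} {j j′} → vertex i j ≡ vertex i′ j′ → i ≡ i′ × j ≡ j′
  vertex-injective eq = combine-injective _ _ _ _ (suc-injective eq)

  data EdgeView {k} : Fin (k * n) → Set where
    edge : (i : Fin k) (j : Fin n) → EdgeView (combine i j)

  edgeView : ∀ {k} e → EdgeView {k} e
  edgeView {k} e = subst EdgeView (combine-remQuot {k} n e) (edge _ _)

  slotEnds : ∀ {k} → Fin k → Fin n → Fin (suc (k * n)) × Fin (suc (k * n))
  slotEnds i zero    = hub , vertex i (suc zero)
  slotEnds i (suc j) = vertex i zero , vertex i (suc j)

  ends-combine : ∀ {k} (i : Fin k) j → ends (B k) (combine i j) ≡ slotEnds i j
  ends-combine i zero    rewrite remQuot-combine {k = n} i zero    = refl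
  ends-combine i (suc j) rewrite remQuot-combine {k = n} i (suc j) = refl

  slot-invariant : ∀ {k} (S : Fin (k * n) → Bool) (P : Fin (suc (k * n)) → Set) →
    (∀ (i : Fin k) j → S (combine i j) ≡ true → P (proj₁ (slotEnds i j)) ⇔ P (proj₂ (slotEnds i j))) →
    ∀ e → S e ≡ true → P (proj₁ (ends (B k) e)) ⇔ P (proj₂ (ends (B k) e))
  slot-invariant {k} S P invariant e Se with edgeView {k} e
  ... | edge i j rewrite ends-combine i j = invariant i j Se

  banana-connected : ∀ {k} a → Walk (B k) (λ _ → true) a hub
  banana-connected     hub     = []
  banana-connected {k} (suc x) with edgeView {k} x
  ... | edge i j = toHub j
    where
    link : ∀ j {x y} → slotEnds i j ≡ (x , y) ⊎ slotEnds i j ≡ (y , x) →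
           Walk (B k) (λ _ → true) y hub → Walk (B k) (λ _ → true) x hub
    link j ends≡ = step (combine i j) refl (subst (λ p → p ≡ _ ⊎ p ≡ _) (sym (ends-combine i j)) ends≡)
    fromLeaf₁ : Walk (B k) (λ _ → true) (vertex i (suc zero)) hub
    fromLeaf₁ = link zero (inj₂ refl) []
    fromCentre : Walk (B k) (λ _ → true) (vertex i zero) hub
    fromCentre = link (suc zero) (inj₁ refl) fromLeaf₁
    toHub : ∀ j → Walk (B k) (λ _ → true) (vertex i j) hub
    toHub zero          = fromCentre
    toHub (suc zero)    = fromLeaf₁
    toHub (suc (suc j)) = link (suc (suc j)) (inj₂ refl) fromCentre

  -- Edge (i , j) has vertex (i , matchSlot j) as its end away from the hub.
  matchSlot : Fin n → Fin n
  matchSlot zero          = suc zero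
  matchSlot (suc zero)    = zero
  matchSlot (suc (suc j)) = suc (suc j)

  matchSlot-involutive : ∀ j → matchSlot (matchSlot j) ≡ j
  matchSlot-involutive zero          = refl
  matchSlot-involutive (suc zero)    = refl
  matchSlot-involutive (suc (suc j)) = refl

  module _ {k : ℕ} where

    copyOf : Fin (k * n) → Fin k
    copyOf x = proj₁ (remQuot {k} n x)

    copyOf-combine : ∀ i j → copyOf (combine i j) ≡ i
    copyOf-combine i j = cong proj₁ (remQuot-combine i j)

    match : Fin (k * n) → Fin (k * n)
    match x = combine (copyOf x) (matchSlot (proj₂ (remQuot {k} n x)))

    match-combine : ∀ (i : Fin k) j → match (combine i j) ≡ combine i (matchSlot j)
    match-combine i j =
      cong (λ (p : Fin k × Fin n) → combine (proj₁ p) (matchSlot (proj₂ p))) (remQuot-combine i j)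

    match-involutive : ∀ (x : Fin (k * n)) → match (match x) ≡ x
    match-involutive x with edgeView {k} x
    ... | edge i j = begin
      match (match (combine i j))        ≡⟨ cong match (match-combine i j) ⟩
      match (combine i (matchSlot j))    ≡⟨ match-combine i (matchSlot j) ⟩
      combine i (matchSlot (matchSlot j)) ≡⟨ cong (combine i) (matchSlot-involutive j) ⟩
      combine i j                        ∎

    match-↔ : Fin (k * n) ↔ Fin (k * n)
    match-↔ = mk↔ₛ′ match match match-involutive match-involutive

    slotEnds-∈ : ∀ (K : Subgraph (B k)) (i : Fin k) j → EK K (combine i j) ≡ true →
                 (VK K (proj₁ (slotEnds i j)) ≡ true) × (VK K (proj₂ (slotEnds i j)) ≡ true)
    slotEnds-∈ K i j e∈K =
      subst (λ p → (VK K (proj₁ p) ≡ true) × (VK K (proj₂ p) ≡ true)) (ends-combine i j) (closed K _ e∈K)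

    lowerEnd-∈ : ∀ (K : Subgraph (B k)) (i : Fin k) j → EK K (combine i j) ≡ true →
                 VK K (vertex i (matchSlot j)) ≡ true
    lowerEnd-∈ K i zero          = proj₂ ∘ slotEnds-∈ K i zero
    lowerEnd-∈ K i (suc zero)    = proj₁ ∘ slotEnds-∈ K i (suc zero)
    lowerEnd-∈ K i (suc (suc j)) = proj₂ ∘ slotEnds-∈ K i (suc (suc j))

    InCopy : Fin k → Fin (suc (k * n)) → Set
    InCopy c u = Σ (Fin n) λ j → u ≡ vertex c j

    inCopy-vertex : ∀ {c i j} → InCopy c (vertex i j) ⇔ i ≡ c
    inCopy-vertex {j = j} = mk⇔ (λ (_ , eq) → proj₁ (vertex-injective eq)) (λ { refl → j , refl })

    module ≅Banana {ℓ} (K : Subgraph (B k)) (iso : K ≅ B (suc ℓ)) where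
      open _≅_ iso

      walk-in-K : ∀ {u w} → VK K u ≡ true → VK K w ≡ true → Walk (B k) (EK K) u w
      walk-in-K = ≅-connected iso hub banana-connected

      -- Otherwise K, being connected, would lie in a single copy of n vertices.
      hub-∈ : VK K hub ≡ true
      hub-∈ with VK K hub in hub∉K
      ... | true  = refl
      ... | false with φ hub | φ-into hub
      ...   | hub   | φhub∈K = contradiction (trans (sym φhub∈K) hub∉K) λ ()
      ...   | suc x | φhub∈K = contradiction (injective⇒≤ slot-injective) (<⇒≱ n<ℓn+1)
        where
        c : Fin k
        c = copyOf x
        inCopy-invariant : ∀ (i : Fin k) j → EK K (combine i j) ≡ true →
                           InCopy c (proj₁ (slotEnds i j)) ⇔ InCopy c (proj₂ (slotEnds i j))
        inCopy-invariant i zero    e∈K =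
          contradiction (trans (sym (proj₁ (slotEnds-∈ K i zero e∈K))) hub∉K) λ ()
        inCopy-invariant i (suc j) _   = ⇔-sym inCopy-vertex ⇔-∘ inCopy-vertex
        φhub-inCopy : InCopy c (suc x)
        φhub-inCopy = proj₂ (remQuot {k} n x) , cong suc (sym (combine-remQuot {k} n x))
        inCopy : ∀ a → InCopy c (φ a)
        inCopy a = walk-transport (InCopy c) (slot-invariant (EK K) (InCopy c) inCopy-invariant)
                                  (walk-in-K φhub∈K (φ-into a)) φhub-inCopy
        slot-injective : Injective _≡_ _≡_ (proj₁ ∘ inCopy)
        slot-injective {a} {b} eq =
          φ-inj a b (trans (proj₂ (inCopy a)) (trans (cong (vertex c) eq) (sym (proj₂ (inCopy b)))))
        n<ℓn+1 : n < suc (suc ℓ * n)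
        n<ℓn+1 = s≤s (m≤m+n n (ℓ * n))

      data HubPath (i : Fin k) : Fin n → Set where
        leaf₁  : EK K (combine i zero) ≡ true → HubPath i (suc zero)
        centre : EK K (combine i (suc zero)) ≡ true → HubPath i (suc zero) → HubPath i zero
        leaf   : ∀ {j} → EK K (combine i (suc (suc j))) ≡ true → HubPath i zero → HubPath i (suc (suc j))

      OnHubPath : Fin (suc (k * n)) → Set
      OnHubPath u = ∀ i j → u ≡ vertex i j → HubPath i j

      onHubPath-vertex : ∀ {i j} → OnHubPath (vertex i j) ⇔ HubPath i j
      onHubPath-vertex = mk⇔ (λ p → p _ _ refl) λ p _ _ eq → reindex (vertex-injective eq) p
        where
        reindex : ∀ {i i′ j j′} → i ≡ i′ × j ≡ j′ → HubPath i j → HubPath i′ j′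
        reindex (refl , refl) p = p

      onHubPath-invariant : ∀ (i : Fin k) j → EK K (combine i j) ≡ true →
                            OnHubPath (proj₁ (slotEnds i j)) ⇔ OnHubPath (proj₂ (slotEnds i j))
      onHubPath-invariant i zero e∈K =
        mk⇔ (λ _ → from onHubPath-vertex (leaf₁ e∈K)) (λ _ _ _ ())
      onHubPath-invariant i (suc zero) e∈K =
        ⇔-sym onHubPath-vertex ⇔-∘ (mk⇔ (λ { (centre _ p) → p }) (centre e∈K) ⇔-∘ onHubPath-vertex)
      onHubPath-invariant i (suc (suc j)) e∈K =
        ⇔-sym onHubPath-vertex ⇔-∘ (mk⇔ (leaf e∈K) (λ { (leaf _ p) → p }) ⇔-∘ onHubPath-vertex)

      hubPath : ∀ {i j} → VK K (vertex i j) ≡ true → HubPath i j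
      hubPath v∈K = to onHubPath-vertex
        (walk-transport OnHubPath (slot-invariant (EK K) OnHubPath onHubPath-invariant)
                        (walk-in-K hub-∈ v∈K) λ _ _ ())

      parentEdge-∈ : ∀ {i j} → HubPath i j → EK K (combine i (matchSlot j)) ≡ true
      parentEdge-∈ (leaf₁ e∈K)    = e∈K
      parentEdge-∈ (centre e∈K _) = e∈K
      parentEdge-∈ (leaf e∈K _)   = e∈K

      match-∈ : ∀ x → EK K (match x) ≡ VK K (suc x)
      match-∈ x with edgeView {k} x
      ... | edge i j rewrite match-combine i j = ⇔→≡ {z = true} (mk⇔ lower (parentEdge-∈ ∘ hubPath))
        where
        lower : EK K (combine i (matchSlot j)) ≡ true → VK K (vertex i j) ≡ true
        lower e∈K = subst (λ j′ → VK K (vertex i j′) ≡ true) (matchSlot-involutive j)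
                          (lowerEnd-∈ K i (matchSlot j) e∈K)

      nonHubCount : sum (λ x → if VK K (suc x) then 1 else 0) ≡ suc ℓ * n
      nonHubCount = ℕ-suc-injective (begin
        suc (sum nonHub)                        ≡⟨ cong (λ b → (if b then 1 else 0) + sum nonHub) hub-∈ ⟨
        sum (λ u → if VK K u then 1 else 0)     ≡⟨ ≅-vertexCount iso ⟩
        suc (suc ℓ * n)                         ∎)
        where
        nonHub : Fin (k * n) → ℕ
        nonHub x = if VK K (suc x) then 1 else 0

    N : ℕ
    N = k * n

    opposite-↔ : Fin N ↔ Fin N
    opposite-↔ = mk↔ₛ′ opposite opposite opposite-involutive opposite-involutive

    -- Vertex u gets label 1 + u and edge match x gets label 2N + 3 − label (suc x).
    labelling-↔ : (Fin (suc N) ⊎ Fin N) ↔ Fin (suc N + N)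
    labelling-↔ = ↔-sym +↔⊎ ↔-∘ (↔-id _ ⊎-↔ (opposite-↔ ↔-∘ match-↔))

    magicLabelling : Labelling (B k)
    magicLabelling = Inverse.to labelling-↔

    labelOf : Fin (suc N) ⊎ Fin N → ℕ
    labelOf = label {B k} magicLabelling

    magicSum : ℕ
    magicSum = 3 + (N + N)

    vertex+edge : ∀ x → labelOf (inj₁ (suc x)) + labelOf (inj₂ (match x)) ≡ magicSum
    vertex+edge x = begin
      suc (suc (toℕ (x ↑ˡ N))) + suc (toℕ (suc N ↑ʳ opposite (match (match x))))
        ≡⟨ cong (λ a → suc (suc (toℕ (x ↑ˡ N))) + suc a) (toℕ-↑ʳ (suc N) _) ⟩
      suc (suc (toℕ (x ↑ˡ N))) + suc (suc N + toℕ (opposite (match (match x))))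
        ≡⟨ cong₂ (λ a y → suc (suc a) + suc (suc N + toℕ (opposite y))) (toℕ-↑ˡ x N) (match-involutive x) ⟩
      suc (suc t) + suc (suc N + toℕ (opposite x))
        ≡⟨ cong (λ a → suc (suc t) + suc (suc N + a)) (opposite-prop x) ⟩
      suc (suc t) + suc (suc N + (N ∸ suc t))
        ≡⟨ regroup t N (N ∸ suc t) ⟩
      3 + (N + (suc t + (N ∸ suc t)))
        ≡⟨ cong (λ a → 3 + (N + a)) (m+[n∸m]≡n (toℕ<n x)) ⟩
      magicSum ∎
      where
      t : ℕ
      t = toℕ x
      regroup : ∀ t N d → suc (suc t) + suc (suc N + d) ≡ 3 + (N + (suc t + d))
      regroup = solve-∀

    verticesFirst : VerticesFirst (B k) magicLabelling
    verticesFirst = bounded , attained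
      where
      bounded : ∀ u → labelOf (inj₁ u) ≤ suc N
      bounded u = subst (λ a → suc a ≤ suc N) (sym (toℕ-↑ˡ u N)) (toℕ<n u)
      attained : ∀ i → 1 ≤ i → i ≤ suc N → ∃ λ u → labelOf (inj₁ u) ≡ i
      attained (suc i) _ i<1+N = fromℕ< i<1+N , cong suc (trans (toℕ-↑ˡ (fromℕ< i<1+N) N) (toℕ-fromℕ< i<1+N))

    masked-+ : ∀ b x y → (if b then x else 0) + (if b then y else 0) ≡ (if b then 1 else 0) * (x + y)
    masked-+ true  x y = sym (*-identityˡ (x + y))
    masked-+ false x y = refl

    weight-≅ : ∀ {ℓ} (K : Subgraph (B k)) → K ≅ B (suc ℓ) →
               weight {B k} magicLabelling K ≡ suc (suc ℓ * n * magicSum)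
    weight-≅ {ℓ} K iso = begin
      weight {B k} magicLabelling K
        ≡⟨ cong₂ _+_ (ΣFin≡sum (suc N) vertexTerm) (ΣFin≡sum N edgeTerm) ⟩
      sum vertexTerm + sum edgeTerm
        ≡⟨ cong₂ _+_ (cong (λ b → (if b then 1 else 0) + sum (vertexTerm ∘ suc)) hub-∈)
                     (sum-permute edgeTerm match-↔) ⟩
      suc (sum (vertexTerm ∘ suc) + sum (edgeTerm ∘ match))
        ≡⟨ cong suc (∑-distrib-+ (vertexTerm ∘ suc) (edgeTerm ∘ match)) ⟨
      suc (sum (λ x → vertexTerm (suc x) + edgeTerm (match x)))
        ≡⟨ cong suc (sum-cong-≗ paired) ⟩
      suc (sum (λ x → nonHub x * magicSum))
        ≡⟨ cong suc (*-distribʳ-sum magicSum nonHub) ⟨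
      suc (sum nonHub * magicSum)
        ≡⟨ cong (λ c → suc (c * magicSum)) nonHubCount ⟩
      suc (suc ℓ * n * magicSum) ∎
      where
      open ≅Banana K iso
      vertexTerm : Fin (suc N) → ℕ
      vertexTerm u = if VK K u then labelOf (inj₁ u) else 0
      edgeTerm : Fin N → ℕ
      edgeTerm e = if EK K e then labelOf (inj₂ e) else 0
      nonHub : Fin N → ℕ
      nonHub x = if VK K (suc x) then 1 else 0
      paired : ∀ x → vertexTerm (suc x) + edgeTerm (match x) ≡ nonHub x * magicSum
      paired x rewrite match-∈ x | sym (vertex+edge x) = masked-+ (VK K (suc x)) _ _

    copies : (Fin k → Bool) → Subgraph (B k)
    copies S = record { VK = inCopies ; EK = S ∘ copyOf ; closed = closed′ }
      where
      inCopies : Fin (suc (k * n)) → Bool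
      inCopies hub     = true
      inCopies (suc x) = S (copyOf x)
      closed′ : ∀ e → S (copyOf e) ≡ true →
                (inCopies (proj₁ (ends (B k) e)) ≡ true) × (inCopies (proj₂ (ends (B k) e)) ≡ true)
      closed′ e e∈ with edgeView {k} e
      ... | edge i j rewrite ends-combine i j | copyOf-combine i j = ends∈ j
        where
        vertex∈ : ∀ j → inCopies (vertex i j) ≡ true
        vertex∈ j = trans (cong S (copyOf-combine i j)) e∈
        ends∈ : ∀ j → (inCopies (proj₁ (slotEnds i j)) ≡ true) × (inCopies (proj₂ (slotEnds i j)) ≡ true)
        ends∈ zero    = refl , vertex∈ (suc zero)
        ends∈ (suc j) = vertex∈ zero , vertex∈ (suc j)

    inImage : ∀ {ℓ} → (Fin ℓ → Fin k) → Fin k → Bool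
    inImage σ i = does (any? λ t → σ t ≟ i)

    module CopiesAlong {ℓ} (σ : Fin ℓ → Fin k) (σ-inj : Injective _≡_ _≡_ σ) where
      K : Subgraph (B k)
      K = copies (inImage σ)

      inImage-σ : ∀ t → inImage σ (σ t) ≡ true
      inImage-σ t = dec-true (any? λ t′ → σ t′ ≟ σ t) (t , refl)

      inImage⇒ : ∀ i → inImage σ i ≡ true → ∃ λ t → σ t ≡ i
      inImage⇒ i with any? (λ t → σ t ≟ i)
      ... | yes p = λ _ → p
      ... | no _  = λ ()

      liftVertex : Fin (suc (ℓ * n)) → Fin (suc (k * n))
      liftVertex hub     = hub
      liftVertex (suc x) = vertex (σ (proj₁ (remQuot {ℓ} n x))) (proj₂ (remQuot {ℓ} n x))

      liftVertex-vertex : ∀ t j → liftVertex (vertex t j) ≡ vertex (σ t) j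
      liftVertex-vertex t j =
        cong (λ (p : Fin ℓ × Fin n) → vertex (σ (proj₁ p)) (proj₂ p)) (remQuot-combine t j)

      liftVertex-injective : ∀ a b → liftVertex a ≡ liftVertex b → a ≡ b
      liftVertex-injective hub     hub     _  = refl
      liftVertex-injective (suc x) (suc y) eq = cong suc (begin
        x                                                      ≡⟨ combine-remQuot {ℓ} n x ⟨
        combine (proj₁ (remQuot {ℓ} n x)) (proj₂ (remQuot {ℓ} n x)) ≡⟨ cong₂ combine (σ-inj copy≡) slot≡ ⟩
        combine (proj₁ (remQuot {ℓ} n y)) (proj₂ (remQuot {ℓ} n y)) ≡⟨ combine-remQuot {ℓ} n y ⟩
        y                                                      ∎)
        where
        copy≡ : σ (proj₁ (remQuot {ℓ} n x)) ≡ σ (proj₁ (remQuot {ℓ} n y))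
        copy≡ = proj₁ (vertex-injective {k} eq)
        slot≡ : proj₂ (remQuot {ℓ} n x) ≡ proj₂ (remQuot {ℓ} n y)
        slot≡ = proj₂ (vertex-injective {k} eq)

      liftVertex-into : ∀ a → VK K (liftVertex a) ≡ true
      liftVertex-into hub     = refl
      liftVertex-into (suc x) = trans (cong (inImage σ) (copyOf-combine _ _)) (inImage-σ _)

      liftVertex-onto : ∀ u → VK K u ≡ true → ∃ λ a → liftVertex a ≡ u
      liftVertex-onto hub     _  = hub , refl
      liftVertex-onto (suc x) u∈ with inImage⇒ _ u∈
      ... | t , σt≡ = vertex t (proj₂ (remQuot {k} n x)) , (begin
        liftVertex (vertex t _)                                ≡⟨ liftVertex-vertex t _ ⟩
        vertex (σ t) (proj₂ (remQuot {k} n x))                 ≡⟨ cong (λ i → vertex i _) σt≡ ⟩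
        suc (combine (copyOf x) (proj₂ (remQuot {k} n x)))     ≡⟨ cong suc (combine-remQuot {k} n x) ⟩
        suc x                                                  ∎)

      liftEnds : Fin (suc (ℓ * n)) × Fin (suc (ℓ * n)) → Fin (suc (k * n)) × Fin (suc (k * n))
      liftEnds = Product.map liftVertex liftVertex

      liftEnds-slotEnds : ∀ t j → slotEnds (σ t) j ≡ liftEnds (slotEnds t j)
      liftEnds-slotEnds t zero    = cong (hub ,_) (sym (liftVertex-vertex t (suc zero)))
      liftEnds-slotEnds t (suc j) = sym (cong₂ _,_ (liftVertex-vertex t zero) (liftVertex-vertex t (suc j)))

      ends-combine-σ : ∀ t j → ends (B k) (combine (σ t) j) ≡ liftEnds (ends (B ℓ) (combine t j))
      ends-combine-σ t j rewrite ends-combine (σ t) j | ends-combine t j = liftEnds-slotEnds t j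

      liftEnds-injective : ∀ p {a b} → liftEnds p ≡ (liftVertex a , liftVertex b) → p ≡ (a , b)
      liftEnds-injective _ eq =
        cong₂ _,_ (liftVertex-injective _ _ (cong proj₁ eq)) (liftVertex-injective _ _ (cong proj₂ eq))

      copies-≅ : K ≅ B ℓ
      copies-≅ = record
        { φ = liftVertex ; φ-inj = liftVertex-injective ; φ-into = liftVertex-into ; φ-onto = liftVertex-onto
        ; adj→ = adj→ ; adj← = adj← }
        where
        adj→ : ∀ a b → (∃ λ h → Joins (B ℓ) h a b) →
               ∃ λ e → (EK K e ≡ true) × Joins (B k) e (liftVertex a) (liftVertex b)
        adj→ a b (h , joins) with edgeView {ℓ} h
        ... | edge t j = combine (σ t) j , trans (cong (inImage σ) (copyOf-combine (σ t) j)) (inImage-σ t)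
                       , Sum.map (lift-ends≡) (lift-ends≡) joins
          where
          lift-ends≡ : ∀ {p} → ends (B ℓ) (combine t j) ≡ p → ends (B k) (combine (σ t) j) ≡ liftEnds p
          lift-ends≡ eq = trans (ends-combine-σ t j) (cong liftEnds eq)
        adj← : ∀ a b → (∃ λ e → (EK K e ≡ true) × Joins (B k) e (liftVertex a) (liftVertex b)) →
               ∃ λ h → Joins (B ℓ) h a b
        adj← a b (e , e∈K , joins) with edgeView {k} e
        ... | edge i j with inImage⇒ i (trans (cong (inImage σ) (sym (copyOf-combine i j))) e∈K)
        ...   | t , refl = combine t j , Sum.map unlift unlift joins
          where
          unlift : ∀ {x y} → ends (B k) (combine (σ t) j) ≡ (liftVertex x , liftVertex y) →
                   ends (B ℓ) (combine t j) ≡ (x , y)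
          unlift eq = liftEnds-injective _ (trans (sym (ends-combine-σ t j)) eq)

  banana-supermagic′ : ∀ {k ℓ} → ℓ ≤ k → Supermagic (B (suc k)) (B (suc ℓ))
  banana-supermagic′ {k} {ℓ} ℓ≤k =
    covering , magicLabelling {suc k} , ↔⇒IsBijection (labelling-↔ {suc k}) , verticesFirst {suc k} ,
    suc (suc ℓ * n * magicSum {suc k}) , weight-≅
    where
    covering : Covering (B (suc k)) (B (suc ℓ))
    covering e = K , copies-≅ , inImage-σ zero
      where open CopiesAlong (headedBy ℓ≤k (copyOf {suc k} e)) (headedBy-injective ℓ≤k (copyOf e))

banana-supermagic : ∀ {n k ℓ} (hn : 2 ≤ n) → 1 ≤ ℓ → ℓ ≤ k → Supermagic (Banana k n hn) (Banana ℓ n hn)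
banana-supermagic {suc (suc m)} (s≤s (s≤s z≤n)) (s≤s z≤n) (s≤s ℓ≤k) = Bananas.banana-supermagic′ m ℓ≤k

mainTheorem4 : (∀ (n k ℓ : ℕ) (hn : 2 ≤ n) → 2 ≤ ℓ → ℓ < k →
                 Supermagic (Banana k n hn) (Banana ℓ n hn))
               × (∀ (n k : ℕ) (hn : 2 ≤ n) → 3 ≤ k →
                 Supermagic (Banana k n hn) (Banana (k ∸ 1) n hn))
mainTheorem4 =
  (λ n k ℓ hn 2≤ℓ ℓ<k → banana-supermagic hn (≤-trans (s≤s z≤n) 2≤ℓ) (<⇒≤ ℓ<k)) ,
  (λ n k hn 3≤k → banana-supermagic hn (≤-trans (s≤s z≤n) (∸-monoˡ-≤ 1 3≤k)) (m∸n≤m k 1))
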